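{- Let $a\geqslant 2$, $b\geqslant 0$ be integers and $\pi\in\mathfrak{S}_n$. Suppose an entry $t=\pi_i$ of $\pi$ does not play the role of $a$ in any occurrence in $\pi$ of any pattern from $\Pi(a,b)$, but $S(\pi)_i$ plays the role of $a$ in some occurrence in $S(\pi)$ of some pattern from $\Pi(a,b)$. Then $t$ is either the entry of value $\underline{a}$ or an $a-1$ element associated with $\underline{a}$ in $\pi$.
   Context: Permutations are written in one-line notation $\pi=\pi_1\ldots\pi_n$; $\mathfrak{S}_n$ is the set of permutations of size $n$. A permutation $\pi$ contains a pattern $\rho$ of size $k$ if some subsequence $\pi_{i_1}\ldots\pi_{i_k}$ ($i_1<\dots<i_k$) is order-isomorphic to $\rho$ (an occurrence); in it, $\pi_{i_j}$ plays the role of the value $\rho_j$. $\pi$ avoids $\rho$ if it does not contain it. $[x,y]$ is the set of integers between $x$ and $y$ inclusive; $\iota_k=12\ldots k$. For integers $c\geqslant1,d\geqslant0$ with $c+d\geqslant 2$, the partial shuffle $\Pi(c,d)$ is the set of permutations of size $c+d$ obtained by writing $[c+d]\setminus\{c\}$ in increasing order and inserting $c$ in every position except the one giving $\iota_{c+d}$. Fix $a\geqslant 2$, $b\geqslant 0$. If $\pi$ contains a pattern from $\Pi(a-1,b+1)$, $\underline{a}$ is the smallest value of an entry of $\pi$ playing the role of $a$ in some occurrence of a pattern from $\Pi(a-1,b+1)$; an entry is an $a-1$ element associated with $\underline{a}$ if it plays the role of $a-1$ in an occurrence of a pattern from $\Pi(a-1,b+1)$ in which the entry of value $\underline{a}$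 plays the role of $a$; $\underline{a-1}$ is the smallest value of such an entry. The map $S:\mathfrak{S}_n\to\mathfrak{S}_n$ (depending on $a,b$) is defined by: $S(\pi)=\pi$ if $\pi$ avoids every pattern of $\Pi(a-1,b+1)$; otherwise $S(\pi)_i=\pi_i+1$ if $\pi_i\in[\underline{a-1},\underline{a}-1]$, $S(\pi)_i=\underline{a-1}$ if $\pi_i=\underline{a}$, and $S(\pi)_i=\pi_i$ otherwise. -}

module Defs where

open import Data.Nat using (ℕ; zero; suc; _+_; _∸_; _≤_; _<_; _<ᵇ_; _≡ᵇ_)
open import Data.Bool using (if_then_else_)
open import Data.Fin using (Fin; toℕ) renaming (_<_ to _<ᶠ_)
open import Data.Product using (Σ; _×_; ∃; ∃-syntax)
open import Data.Sum using (_⊎_)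
open import Relation.Binary.PropositionalEquality using (_≡_; _≢_)
open import Relation.Nullary using (¬_)
open import Function.Definitions using (Injective)

IsPerm : (n : ℕ) → (Fin n → ℕ) → Set
IsPerm n π = Injective _≡_ _≡_ π × (∀ i → 1 ≤ π i × π i ≤ n)

record Occurrence {n k : ℕ} (π : Fin n → ℕ) (ρ : Fin k → ℕ) : Set where
  field
    pos     : Fin k → Fin n
    incr    : ∀ j j' → j <ᶠ j' → pos j <ᶠ pos j'
    iso→    : ∀ j j' → ρ j < ρ j' → π (pos j) < π (pos j')
    iso←    : ∀ j j' → π (pos j) < π (pos j') → ρ j < ρ j'
open Occurrence public

PlaysRole : {n k : ℕ} {π : Fin n → ℕ} {ρ : Fin k → ℕ} →
            Occurrence π ρ → Fin n → ℕ → Set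
PlaysRole {ρ = ρ} o i v = ∃[ j ] (ρ j ≡ v × pos o j ≡ i)

-- The list [c+d] \ {c} in increasing order, 0-indexed: m ↦ m+1 if m+1 < c, else m+2.
restElem : ℕ → ℕ → ℕ
restElem c m = if suc m <ᵇ c then suc m else suc (suc m)

-- Insert c at (0-indexed) position p into that list; value at index m.
shuffleVal : ℕ → ℕ → ℕ → ℕ
shuffleVal c p m =
  if m <ᵇ p then restElem c m
  else if m ≡ᵇ p then c
  else restElem c (m ∸ 1)

-- ρ ∈ Π(c,d): ρ is obtained by inserting c at a position p other than c-1
-- (position c-1 gives the identity).
InΠ : (c d : ℕ) → (Fin (c + d) → ℕ) → Set
InΠ c d ρ = ∃[ p ] (toℕ {c + d} p ≢ c ∸ 1 × (∀ j → ρ j ≡ shuffleVal c (toℕ p) (toℕ j)))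

RoleΠ : (c d : ℕ) {n : ℕ} → (Fin n → ℕ) → Fin n → ℕ → Set
RoleΠ c d π i v =
  Σ (Fin (c + d) → ℕ) λ ρ → InΠ c d ρ × Σ (Occurrence π ρ) λ o → PlaysRole o i v

ContainsΠ : (c d : ℕ) {n : ℕ} → (Fin n → ℕ) → Set
ContainsΠ c d π = Σ (Fin (c + d) → ℕ) λ ρ → InΠ c d ρ × Occurrence π ρ

IsUnderA : (a b : ℕ) {n : ℕ} → (Fin n → ℕ) → ℕ → Set
IsUnderA a b π u =
  (∃[ i ] (π i ≡ u × RoleΠ (a ∸ 1) (suc b) π i a)) ×
  (∀ i → RoleΠ (a ∸ 1) (suc b) π i a → u ≤ π i)

AssocA1 : (a b : ℕ) {n : ℕ} → (Fin n → ℕ) → ℕ → Fin n → Set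
AssocA1 a b π u i =
  Σ (Fin ((a ∸ 1) + suc b) → ℕ) λ ρ → InΠ (a ∸ 1) (suc b) ρ ×
  Σ (Occurrence π ρ) λ o → PlaysRole o i (a ∸ 1) ×
  ∃[ k ] (PlaysRole o k a × π k ≡ u)

IsUnderA1 : (a b : ℕ) {n : ℕ} → (Fin n → ℕ) → ℕ → ℕ → Set
IsUnderA1 a b π u w =
  (∃[ i ] (π i ≡ w × AssocA1 a b π u i)) ×
  (∀ i → AssocA1 a b π u i → w ≤ π i)

shiftVal : ℕ → ℕ → ℕ → ℕ
shiftVal w u x =
  if x <ᵇ w then x
  else if x <ᵇ u then suc x
  else if x ≡ᵇ u then w
  else x

-- σ = S(π) (for parameters a, b).  The two minima are uniquely determined, so
-- this relation is the graph of the map S.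
data IsS (a b : ℕ) {n : ℕ} (π : Fin n → ℕ) : (Fin n → ℕ) → Set where
  avoid : ¬ ContainsΠ (a ∸ 1) (suc b) π → IsS a b π π
  move  : (u w : ℕ) → IsUnderA a b π u → IsUnderA1 a b π u w →
          IsS a b π (λ i → shiftVal w u (π i))

{-# OPTIONS --safe #-}
-- Occurrences are handled as chains: x plays the role t+1 in an occurrence of a pattern of
-- Π(t+1,d) iff the other t+d entries of the occurrence, read from left to right, increase in
-- value, the first t lie below x and the others above it, and x is not placed between the t-th
-- and the (t+1)-th of them. With a = t+2, take a chain P at the entry j of value w =
-- \underline{a-1} whose entry k of index t has value u = \underline{a}, and a chain O in S(π)
-- at i. S rotates the values in [w,u] (u goes down to w, the others up by one), so the only
-- comparisons it changes involve k; hence O passes through k, for otherwise it is a chain in π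
-- at i. If π_i > u, the first t entries of P followed by those of O from index t on form a
-- chain in π at i; if π_i < w, so do the entries of O up to k followed by those of P from k
-- on. If π_i = w then i = j. If w < π_i < u, then i can replace j in P, which makes it an a-1
-- element associated with u, unless i lies left of k and right of the first t entries of P;
-- but then inserting i in front of k gives a chain at j in which i plays the role a with value
-- π_i < u, contradicting the minimality of u.
module Submission where

open import Defs
open import Data.Nat
  using (ℕ; zero; suc; _+_; _∸_; _≤_; _<_; _≮_; _<ᵇ_; _≡ᵇ_; z≤n; s≤s; s≤s⁻¹; z<s; _<?_; _≟_)
open import Data.Nat.Properties
open import Data.Fin.Properties using (toℕ-injective; toℕ<n; toℕ-fromℕ<)
import Data.Fin as Fin
open import Data.Fin using (Fin; toℕ; fromℕ<) renaming (_<_ to _<ᶠ_; _≤_ to _≤ᶠ_)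
open import Data.Bool using (true; false; if_then_else_)
open import Data.Bool.Properties using (T-≡; ¬-not)
open import Data.Empty using (⊥; ⊥-elim)
open import Data.Product using (Σ; _×_; _,_; proj₁; proj₂; ∃; ∃-syntax)
open import Data.Sum using (_⊎_; inj₁; inj₂; map₂)
open import Function using (_∘_; Equivalence)
open import Relation.Binary using (tri<; tri≈; tri>)
open import Relation.Binary.PropositionalEquality
open import Relation.Nullary using (¬_; yes; no; contradiction)
open import Relation.Unary using (Decidable)
open import Function.Definitions using (Injective)

private variable
  A : Set
  m m' p q t L : ℕ

<ᵇ-true : m < q → (m <ᵇ q) ≡ true
<ᵇ-true = Equivalence.to T-≡ ∘ <⇒<ᵇ

<ᵇ-false : m ≮ q → (m <ᵇ q) ≡ false
<ᵇ-false {m} {q} m≮q = ¬-not (m≮q ∘ <ᵇ⇒< m q ∘ Equivalence.from T-≡)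

≡ᵇ-false : m ≢ q → (m ≡ᵇ q) ≡ false
≡ᵇ-false {m} {q} m≢q = ¬-not (m≢q ∘ ≡ᵇ⇒≡ m q ∘ Equivalence.from T-≡)

module _ {x y : A} where

  if-< : m < q → (if m <ᵇ q then x else y) ≡ x
  if-< m<q rewrite <ᵇ-true m<q = refl

  if-≮ : m ≮ q → (if m <ᵇ q then x else y) ≡ y
  if-≮ m≮q rewrite <ᵇ-false m≮q = refl

  if-≡ : (if m ≡ᵇ m then x else y) ≡ x
  if-≡ {m} rewrite Equivalence.to T-≡ (≡⇒≡ᵇ m m refl) = refl

  if-≢ : m ≢ q → (if m ≡ᵇ q then x else y) ≡ y
  if-≢ m≢q rewrite ≡ᵇ-false m≢q = refl

Increasing : (A → A → Set) → ℕ → (ℕ → A) → Set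
Increasing _R_ L s = ∀ {m m'} → m < m' → m' < L → s m R s m'

increasing-reflects-< : (f : ℕ → ℕ) → Increasing _<_ L f → m < L → f m < f m' → m < m'
increasing-reflects-< {m = m} {m'} f f-inc m<L fm<fm' with <-cmp m m'
... | tri< m<m' _ _ = m<m'
... | tri≈ _ refl _ = contradiction fm<fm' (n≮n _)
... | tri> _ _ m'<m = contradiction fm<fm' (<⇒≯ (f-inc m'<m m<L))

splice : ℕ → (ℕ → A) → (ℕ → A) → ℕ → A
splice q f g m = if m <ᵇ q then f m else g m

module _ {f g : ℕ → A} where

  splice-< : m < q → splice q f g m ≡ f m
  splice-< = if-<

  splice-≥ : q ≤ m → splice q f g m ≡ g m
  splice-≥ = if-≮ ∘ ≤⇒≯

  splice-elim : (P : ℕ → A → Set) → (∀ {m} → m < q → P m (f m)) → (∀ {m} → q ≤ m → P m (g m)) →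
                ∀ m → P m (splice q f g m)
  splice-elim {q = q} P Pf Pg m with m <? q
  ... | yes m<q = subst (P m) (sym (splice-< m<q)) (Pf m<q)
  ... | no m≮q = subst (P m) (sym (splice-≥ (≮⇒≥ m≮q))) (Pg (≮⇒≥ m≮q))

  splice-increasing : {_R_ : A → A → Set} →
    (∀ {m m'} → m < m' → m' < q → f m R f m') →
    (∀ {m m'} → q ≤ m → m < m' → m' < L → g m R g m') →
    (∀ {m m'} → m < q → q ≤ m' → m' < L → f m R g m') →
    Increasing _R_ L (splice q f g)
  splice-increasing {q = q} ff gg fg {m} {m'} m<m' m'<L with m <? q | m' <? q
  ... | yes m<q | yes m'<q rewrite splice-< m<q | splice-< m'<q = ff m<m' m'<q
  ... | yes m<q | no m'≮q rewrite splice-< m<q | splice-≥ (≮⇒≥ m'≮q) = fg m<q (≮⇒≥ m'≮q) m'<L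
  ... | no m≮q | yes m'<q = contradiction (<-trans m<m' m'<q) m≮q
  ... | no m≮q | no m'≮q rewrite splice-≥ (≮⇒≥ m≮q) | splice-≥ (≮⇒≥ m'≮q) =
    gg (≮⇒≥ m≮q) m<m' m'<L

-- Defs.shuffleVal c p is definitionally insert p c (restElem c).
insert : ℕ → A → (ℕ → A) → ℕ → A
insert p x s m = if m <ᵇ p then s m else if m ≡ᵇ p then x else s (m ∸ 1)

skip : ℕ → ℕ → ℕ
skip p = splice p (λ m → m) suc

data InsertView (p : ℕ) : ℕ → Set where
  before : m < p → InsertView p m
  at     : InsertView p p
  after  : p ≤ m → InsertView p (suc m)

viewed : A → (ℕ → A) → InsertView p m → A
viewed x s (before {m} _) = s m
viewed x s at             = x
viewed x s (after {m} _)  = s m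

insertView : ∀ p m → InsertView p m
insertView p m with <-cmp m p
insertView p m       | tri< m<p _ _  = before m<p
insertView p m       | tri≈ _ refl _ = at
insertView p (suc m) | tri> _ _ p<sm = after (s≤s⁻¹ p<sm)

module _ {x : A} {s : ℕ → A} where

  insert-< : m < p → insert p x s m ≡ s m
  insert-< = if-<

  insert-at : insert p x s p ≡ x
  insert-at {p} = trans (if-≮ (n≮n p)) (if-≡ {m = p})

  insert-> : p ≤ m → insert p x s (suc m) ≡ s m
  insert-> p≤m = trans (if-≮ (<⇒≯ (s≤s p≤m))) (if-≢ (≢-sym (<⇒≢ (s≤s p≤m))))

  insert-skip : ∀ p m → insert p x s (skip p m) ≡ s m
  insert-skip p m with m <? p
  ... | yes m<p rewrite if-< {x = m} {y = suc m} m<p = insert-< m<p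
  ... | no m≮p rewrite if-≮ {x = m} {y = suc m} m≮p = insert-> (≮⇒≥ m≮p)

  insert-≡-inv : (∀ m → s m ≢ x) → insert p x s m ≡ x → m ≡ p
  insert-≡-inv {p} {m} s≢x e with insertView p m
  ... | before m<p = contradiction (trans (sym (insert-< m<p)) e) (s≢x m)
  ... | at         = refl
  ... | after p≤m  = contradiction (trans (sym (insert-> p≤m)) e) (s≢x _)

  insert-viewed : (v : InsertView p m) → insert p x s m ≡ viewed x s v
  insert-viewed (before m<p) = insert-< m<p
  insert-viewed {p = p} at   = insert-at {p = p}
  insert-viewed (after p≤m)  = insert-> p≤m

  insert-increasing : {_R_ : A → A → Set} → p ≤ L → Increasing _R_ L s →
    (∀ {m} → m < p → s m R x) → (∀ {m} → p ≤ m → m < L → x R s m) →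
    Increasing _R_ (suc L) (insert p x s)
  insert-increasing {p = p} {L = L} {_R_ = _R_} p≤L s-inc s<x x<s {m} {m'} m<m' m'<sL =
    subst₂ _R_ (sym (insert-viewed v)) (sym (insert-viewed v')) (go v v' m<m' m'<sL)
    where
    v : InsertView p m
    v = insertView p m
    v' : InsertView p m'
    v' = insertView p m'
    go : ∀ {m m'} (v : InsertView p m) (v' : InsertView p m') → m < m' → m' < suc L →
         viewed x s v R viewed x s v'
    go (before m<p) (before m'<p) m<m' _    = s-inc m<m' (<-≤-trans m'<p p≤L)
    go (before m<p) at            _    _    = s<x m<p
    go (before m<p) (after p≤m')  _    m'<L = s-inc (<-≤-trans m<p p≤m') (s≤s⁻¹ m'<L)
    go at           (before m'<p) m<m' _    = contradiction m<m' (<⇒≯ m'<p)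
    go at           at            m<m' _    = contradiction m<m' (n≮n p)
    go at           (after p≤m')  _    m'<L = x<s p≤m' (s≤s⁻¹ m'<L)
    go (after p≤m)  (before m'<p) m<m' _    = contradiction (<-trans m<m' m'<p) (<⇒≯ (s≤s p≤m))
    go (after p≤m)  at            m<m' _    = contradiction m<m' (<⇒≯ (s≤s p≤m))
    go (after p≤m)  (after p≤m')  m<m' m'<L = s-inc (s≤s⁻¹ m<m') (s≤s⁻¹ m'<L)

insert-map : ∀ {B : Set} (f : A → B) p x s m → f (insert p x s m) ≡ insert p (f x) (f ∘ s) m
insert-map f p x s m with m <ᵇ p
... | true  = refl
... | false with m ≡ᵇ p
...   | true  = refl
...   | false = refl

insert-preserves-< : {f g : ℕ → ℕ} {c y : ℕ} → p ≤ L →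
  (∀ {m m'} → m < L → m' < L → f m < f m' → g m < g m') →
  (∀ {m} → m < L → f m < c → g m < y) →
  (∀ {m} → m < L → c < f m → y < g m) →
  ∀ {m m'} → m < suc L → m' < suc L → insert p c f m < insert p c f m' → insert p y g m < insert p y g m'
insert-preserves-< {p = p} {L = L} {f = f} {g} {c} {y} p≤L ff fc cf {m} {m'} m<sL m'<sL lt =
  subst₂ _<_ (sym (insert-viewed v)) (sym (insert-viewed v'))
    (go v v' m<sL m'<sL (subst₂ _<_ (insert-viewed v) (insert-viewed v') lt))
  where
  v : InsertView p m
  v = insertView p m
  v' : InsertView p m'
  v' = insertView p m'
  go : ∀ {m m'} (v : InsertView p m) (v' : InsertView p m') → m < suc L → m' < suc L →
       viewed c f v < viewed c f v' → viewed y g v < viewed y g v'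
  go (before m<p) (before m'<p) _   _    = ff (<-≤-trans m<p p≤L) (<-≤-trans m'<p p≤L)
  go (before m<p) at            _   _    = fc (<-≤-trans m<p p≤L)
  go (before m<p) (after _)     _   m'<L = ff (<-≤-trans m<p p≤L) (s≤s⁻¹ m'<L)
  go at           (before m'<p) _   _    = cf (<-≤-trans m'<p p≤L)
  go at           at            _   _    = λ c<c → contradiction c<c (n≮n c)
  go at           (after _)     _   m'<L = cf (s≤s⁻¹ m'<L)
  go (after _)    (before m'<p) m<L _    = ff (s≤s⁻¹ m<L) (<-≤-trans m'<p p≤L)
  go (after _)    at            m<L _    = fc (s≤s⁻¹ m<L)
  go (after _)    (after _)     m<L m'<L = ff (s≤s⁻¹ m<L) (s≤s⁻¹ m'<L)

skip-increasing : ∀ p → Increasing _<_ L (skip p)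
skip-increasing p = splice-increasing {f = λ m → m} {g = suc} {q = p} {_R_ = _<_}
  (λ m<m' _ → m<m') (λ _ m<m' _ → s≤s m<m') (λ m<p p≤m' _ → m≤n⇒m≤1+n (<-≤-trans m<p p≤m'))

skip-≤ : ∀ p m → skip p m ≤ suc m
skip-≤ p m with m <? p
... | yes m<p rewrite splice-< {f = λ m → m} {g = suc} m<p = n≤1+n m
... | no m≮p rewrite splice-≥ {f = λ m → m} {g = suc} (≮⇒≥ m≮p) = ≤-refl

-- restElem (suc t) is definitionally splice t suc (suc ∘ suc).
restElem-increasing : ∀ t → Increasing _<_ L (restElem (suc t))
restElem-increasing t = splice-increasing {f = suc} {g = suc ∘ suc} {q = t} {_R_ = _<_}
  (λ m<m' _ → s≤s m<m') (λ _ m<m' _ → s≤s (s≤s m<m'))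
  (λ m<t t≤m' _ → s≤s (m≤n⇒m≤1+n (<-≤-trans m<t t≤m')))

restElem-below : m < t → restElem (suc t) m < suc t
restElem-below m<t rewrite splice-< {f = suc} {g = suc ∘ suc} m<t = s≤s m<t

restElem-above : t ≤ m → suc t < restElem (suc t) m
restElem-above t≤m rewrite splice-≥ {f = suc} {g = suc ∘ suc} t≤m = s≤s (s≤s t≤m)

restElem-below⁻¹ : restElem (suc t) m < suc t → m < t
restElem-below⁻¹ {t} {m} r<st with m <? t
... | yes m<t = m<t
... | no m≮t  = contradiction r<st (<⇒≯ (restElem-above (≮⇒≥ m≮t)))

restElem-above⁻¹ : suc t < restElem (suc t) m → t ≤ m
restElem-above⁻¹ {t} {m} st<r with m <? t
... | yes m<t = contradiction st<r (<⇒≯ (restElem-below m<t))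
... | no m≮t  = ≮⇒≥ m≮t

restElem-≢ : ∀ t m → restElem (suc t) m ≢ suc t
restElem-≢ t m e with m <? t
... | yes m<t = <⇒≢ (restElem-below m<t) e
... | no m≮t  = <⇒≢ (restElem-above (≮⇒≥ m≮t)) (sym e)

restElem-at : ∀ t → restElem (suc t) t ≡ suc (suc t)
restElem-at t = splice-≥ {f = suc} {g = suc ∘ suc} ≤-refl

module _ {w u : ℕ} (w<u : w < u) where

  private variable x y : ℕ

  shift-low : x < w → shiftVal w u x ≡ x
  shift-low = if-<

  shift-mid : w ≤ x → x < u → shiftVal w u x ≡ suc x
  shift-mid w≤x x<u = trans (if-≮ (≤⇒≯ w≤x)) (if-< x<u)

  shift-at : shiftVal w u u ≡ w
  shift-at = trans (if-≮ (<⇒≯ w<u)) (trans (if-≮ (n≮n u)) (if-≡ {m = u}))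

  shift-high : u < x → shiftVal w u x ≡ x
  shift-high u<x = trans (if-≮ (<⇒≯ (<-trans w<u u<x))) (trans (if-≮ (<⇒≯ u<x)) (if-≢ (≢-sym (<⇒≢ u<x))))

  data ShiftView : ℕ → Set where
    low  : x < w → ShiftView x
    mid  : w ≤ x → x < u → ShiftView x
    at   : ShiftView u
    high : u < x → ShiftView x

  shiftView : ∀ x → ShiftView x
  shiftView x with x <? w | <-cmp x u
  ... | yes x<w | _            = low x<w
  ... | no x≮w  | tri< x<u _ _ = mid (≮⇒≥ x≮w) x<u
  ... | no _    | tri≈ _ refl _ = at
  ... | no _    | tri> _ _ u<x = high u<x

  shift-increasing : x ≢ u → y ≢ u → x < y → shiftVal w u x < shiftVal w u y
  shift-increasing {x} {y} x≢u y≢u x<y with shiftView x | shiftView y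
  ... | at | _ = contradiction refl x≢u
  ... | _ | at = contradiction refl y≢u
  ... | low x<w       | low y<w       rewrite shift-low x<w | shift-low y<w = x<y
  ... | low x<w       | mid w≤y y<u   rewrite shift-low x<w | shift-mid w≤y y<u = m≤n⇒m≤1+n x<y
  ... | low x<w       | high u<y      rewrite shift-low x<w | shift-high u<y = x<y
  ... | mid w≤x _     | low y<w       = contradiction (<-trans x<y y<w) (≤⇒≯ w≤x)
  ... | mid w≤x x<u   | mid w≤y y<u   rewrite shift-mid w≤x x<u | shift-mid w≤y y<u = s≤s x<y
  ... | mid w≤x x<u   | high u<y      rewrite shift-mid w≤x x<u | shift-high u<y = <-≤-trans (s≤s x<u) u<y
  ... | high u<x      | low y<w       = contradiction (<-trans x<y y<w) (<⇒≯ (<-trans w<u u<x))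
  ... | high u<x      | mid _ y<u     = contradiction (<-trans x<y y<u) (<⇒≯ u<x)
  ... | high u<x      | high u<y      rewrite shift-high u<x | shift-high u<y = x<y

  shift-reflects-< : x ≢ u → y ≢ u → shiftVal w u x < shiftVal w u y → x < y
  shift-reflects-< {x} {y} x≢u y≢u sx<sy with <-cmp x y
  ... | tri< x<y _ _ = x<y
  ... | tri≈ _ refl _ = contradiction sx<sy (n≮n _)
  ... | tri> _ _ y<x = contradiction sx<sy (<⇒≯ (shift-increasing y≢u x≢u y<x))

  shift-fixed-below-w : shiftVal w u x < w → shiftVal w u x ≡ x
  shift-fixed-below-w {x} sx<w with shiftView x
  ... | low x<w     = shift-low x<w
  ... | mid w≤x x<u = contradiction (subst (_< w) (shift-mid w≤x x<u) sx<w) (≤⇒≯ (m≤n⇒m≤1+n w≤x))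
  ... | at          = contradiction (subst (_< w) shift-at sx<w) (n≮n w)
  ... | high u<x    = shift-high u<x

  shift-fixed-above-u : u < shiftVal w u x → shiftVal w u x ≡ x
  shift-fixed-above-u {x} u<sx with shiftView x
  ... | low x<w     = shift-low x<w
  ... | mid w≤x x<u = contradiction (subst (u <_) (shift-mid w≤x x<u) u<sx) (≤⇒≯ x<u)
  ... | at          = contradiction (subst (u <_) shift-at u<sx) (<⇒≯ w<u)
  ... | high u<x    = shift-high u<x

  shift-above-w : w < shiftVal w u x → w ≤ x
  shift-above-w {x} w<sx with shiftView x
  ... | low x<w     = contradiction (subst (w <_) (shift-low x<w) w<sx) (<⇒≯ x<w)
  ... | mid w≤x _   = w≤x
  ... | at          = <⇒≤ w<u
  ... | high u<x    = <⇒≤ (<-trans w<u u<x)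

_↗[_]_ : {n : ℕ} → Fin n → (Fin n → ℕ) → Fin n → Set
q ↗[ π ] q' = q <ᶠ q' × π q < π q'

-- The entries other than x of an occurrence of a pattern of Π(t+1, L-t) in which x plays
-- the role t+1, listed from left to right; `misplaced` says the pattern is not the identity.
record Chain (t L : ℕ) {n : ℕ} (π : Fin n → ℕ) (x : Fin n) : Set where
  field
    ch         : ℕ → Fin n
    increasing : Increasing _↗[ π ]_ L ch
    lower      : ∀ {m} → m < t → π (ch m) < π x
    upper      : ∀ {m} → t ≤ m → m < L → π x < π (ch m)
    misplaced  : (∃[ m ] m < t × x <ᶠ ch m) ⊎ (∃[ m ] t ≤ m × m < L × ch m <ᶠ x)

  increasing-positions : Increasing _<ᶠ_ L ch
  increasing-positions m<m' m'<L = proj₁ (increasing m<m' m'<L)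

  increasing-values : Increasing _<_ L (π ∘ ch)
  increasing-values m<m' m'<L = proj₂ (increasing m<m' m'<L)

  ch≢x : ∀ {m} → m < L → ch m ≢ x
  ch≢x {m} m<L ch≡x with m <? t
  ... | yes m<t = <⇒≢ (lower m<t) (cong π ch≡x)
  ... | no m≮t  = <⇒≢ (upper (≮⇒≥ m≮t) m<L) (cong π (sym ch≡x))

  increasing-≤ : ∀ {m m'} → m ≤ m' → m' < L → ch m ≤ᶠ ch m' × π (ch m) ≤ π (ch m')
  increasing-≤ {m} {m'} m≤m' m'<L with m ≟ m'
  ... | yes refl = ≤-refl , ≤-refl
  ... | no m≢m'  = let (l , v) = increasing (≤∧≢⇒< m≤m' m≢m') m'<L in <⇒≤ l , <⇒≤ v

  ch-injective : ∀ {m m'} → m < L → m' < L → ch m ≡ ch m' → m ≡ m'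
  ch-injective {m} {m'} m<L m'<L e with <-cmp m m'
  ... | tri< m<m' _ _ = contradiction (cong toℕ e) (<⇒≢ (increasing-positions m<m' m'<L))
  ... | tri≈ _ m≡m' _ = m≡m'
  ... | tri> _ _ m'<m = contradiction (cong toℕ e) (≢-sym (<⇒≢ (increasing-positions m'<m m<L)))

open Chain

resize : ∀ {t L L' n} {π : Fin n → ℕ} {x} → L ≡ L' → Chain t L π x → Chain t L' π x
resize {L' = L'} L≡L' C = record
  { ch         = ch C
  ; increasing = λ m<m' m'<L' → increasing C m<m' (<L m'<L')
  ; lower      = lower C
  ; upper      = λ t≤m m<L' → upper C t≤m (<L m<L')
  ; misplaced  = map₂ (λ (m , t≤m , m<L , lt) → m , t≤m , subst (m <_) L≡L' m<L , lt) (misplaced C)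
  }
  where
  <L : ∀ {m} → m < L' → m < _
  <L = subst (_ <_) (sym L≡L')

least : (Q : ℕ → Set) → Decidable Q → ∀ L →
        ∃[ p ] p ≤ L × (∀ {m} → m < p → ¬ Q m) × (p < L → Q p)
least Q Q? zero = 0 , z≤n , (λ ()) , (λ ())
least Q Q? (suc L) with Q? 0
... | yes Q0 = 0 , z≤n , (λ ()) , (λ _ → Q0)
... | no ¬Q0 =
  let (p , p≤L , none , found) = least (Q ∘ suc) (Q? ∘ suc) L
      none' : ∀ {m} → m < suc p → ¬ Q m
      none' = λ { {zero} _ → ¬Q0 ; {suc m} sm<sp → none (s≤s⁻¹ sm<sp) }
  in suc p , s≤s p≤L , none' , found ∘ s≤s⁻¹

module ChainOccurrence {t d n : ℕ} {π : Fin n → ℕ} {x : Fin n} (C : Chain t (t + d) π x) where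

  private
    first-right : ∃[ p ] p ≤ t + d × (∀ {m} → m < p → ¬ x <ᶠ ch C m) × (p < t + d → x <ᶠ ch C p)
    first-right = least (λ m → x <ᶠ ch C m) (λ m → toℕ x <? toℕ (ch C m)) (t + d)

  slot : ℕ
  slot = proj₁ first-right

  slot≤L : slot ≤ t + d
  slot≤L = proj₁ (proj₂ first-right)

  left-of-x : ∀ {m} → m < slot → ch C m <ᶠ x
  left-of-x {m} m<slot = ≤∧≢⇒< (≮⇒≥ (proj₁ (proj₂ (proj₂ first-right)) m<slot))
                            (ch≢x C (<-≤-trans m<slot slot≤L) ∘ toℕ-injective)

  right-of-x : ∀ {m} → slot ≤ m → m < t + d → x <ᶠ ch C m
  right-of-x slot≤m m<L =
    <-≤-trans (proj₂ (proj₂ (proj₂ first-right)) (≤-<-trans slot≤m m<L)) (proj₁ (increasing-≤ C slot≤m m<L))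

  slot≢t : slot ≢ t
  slot≢t slot≡t with misplaced C
  ... | inj₁ (m , m<t , x<ch) = <-asym x<ch (left-of-x (subst (m <_) (sym slot≡t) m<t))
  ... | inj₂ (m , t≤m , m<L , ch<x) = <-asym ch<x (right-of-x (subst (_≤ m) (sym slot≡t) t≤m) m<L)

  ρ : Fin (suc (t + d)) → ℕ
  ρ j = shuffleVal (suc t) slot (toℕ j)

  position : Fin (suc (t + d)) → Fin n
  position j = insert slot x (ch C) (toℕ j)

  π-position : ∀ j → π (position j) ≡ insert slot (π x) (π ∘ ch C) (toℕ j)
  π-position j = insert-map π slot x (ch C) (toℕ j)

  occurrence : Occurrence π ρ
  occurrence = record
    { pos  = position
    ; incr = λ j j' j<j' →
               insert-increasing {_R_ = _<ᶠ_} slot≤L (increasing-positions C) left-of-x right-of-x j<j' (toℕ<n j')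
    ; iso→ = λ j j' ρj<ρj' → subst₂ _<_ (sym (π-position j)) (sym (π-position j'))
               (insert-preserves-< slot≤L restElem→π restElem→lower restElem→upper (toℕ<n j) (toℕ<n j') ρj<ρj')
    ; iso← = λ j j' πj<πj' →
               insert-preserves-< slot≤L π→restElem lower→restElem upper→restElem (toℕ<n j) (toℕ<n j')
               (subst₂ _<_ (π-position j) (π-position j') πj<πj')
    }
    where
    restElem→π : ∀ {m m'} → m < t + d → m' < t + d →
                 restElem (suc t) m < restElem (suc t) m' → π (ch C m) < π (ch C m')
    restElem→π m<L m'<L r<r' = increasing-values C (increasing-reflects-< _ (restElem-increasing t) (n<1+n _) r<r') m'<L
    restElem→lower : ∀ {m} → m < t + d → restElem (suc t) m < suc t → π (ch C m) < π x
    restElem→lower _ = lower C ∘ restElem-below⁻¹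
    restElem→upper : ∀ {m} → m < t + d → suc t < restElem (suc t) m → π x < π (ch C m)
    restElem→upper m<L = (λ t≤m → upper C t≤m m<L) ∘ restElem-above⁻¹
    π→restElem : ∀ {m m'} → m < t + d → m' < t + d →
                 π (ch C m) < π (ch C m') → restElem (suc t) m < restElem (suc t) m'
    π→restElem m<L m'<L π<π' =
      restElem-increasing t (increasing-reflects-< (π ∘ ch C) (increasing-values C) m<L π<π') (n<1+n _)
    lower→restElem : ∀ {m} → m < t + d → π (ch C m) < π x → restElem (suc t) m < suc t
    lower→restElem {m} m<L πm<πx with m <? t
    ... | yes m<t = restElem-below m<t
    ... | no m≮t  = contradiction πm<πx (<⇒≯ (upper C (≮⇒≥ m≮t) m<L))
    upper→restElem : ∀ {m} → m < t + d → π x < π (ch C m) → suc t < restElem (suc t) m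
    upper→restElem {m} m<L πx<πm with m <? t
    ... | yes m<t = contradiction πx<πm (<⇒≯ (lower C m<t))
    ... | no m≮t  = restElem-above (≮⇒≥ m≮t)

  slotFin : Fin (suc (t + d))
  slotFin = fromℕ< (s≤s slot≤L)

  toℕ-slotFin : toℕ slotFin ≡ slot
  toℕ-slotFin = toℕ-fromℕ< (s≤s slot≤L)

  ρ∈Π : InΠ (suc t) d ρ
  ρ∈Π = slotFin , slot≢t ∘ trans (sym toℕ-slotFin) ,
        (λ j → cong (λ q → shuffleVal (suc t) q (toℕ j)) (sym toℕ-slotFin))

  x-plays : PlaysRole occurrence x (suc t)
  x-plays = slotFin , trans (cong (shuffleVal (suc t) slot) toℕ-slotFin) (insert-at {x = suc t} {restElem (suc t)} {slot}) ,
                      trans (cong (insert slot x (ch C)) toℕ-slotFin) (insert-at {x = x} {ch C} {slot})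

  ch-plays : ∀ {m} → m < t + d → PlaysRole occurrence (ch C m) (restElem (suc t) m)
  ch-plays {m} m<L = j , trans (cong (shuffleVal (suc t) slot) toℕ-j) (insert-skip {x = suc t} {restElem (suc t)} slot m) ,
                         trans (cong (insert slot x (ch C)) toℕ-j) (insert-skip {x = x} {ch C} slot m)
    where
    skip<sL : skip slot m < suc (t + d)
    skip<sL = s≤s (≤-trans (skip-≤ slot m) m<L)
    j : Fin (suc (t + d))
    j = fromℕ< skip<sL
    toℕ-j : toℕ j ≡ skip slot m
    toℕ-j = toℕ-fromℕ< skip<sL

  next-plays : t < t + d → PlaysRole occurrence (ch C t) (suc (suc t))
  next-plays t<L = subst (PlaysRole occurrence (ch C t)) (restElem-at t) (ch-plays t<L)

module _ {t d n : ℕ} {π : Fin n → ℕ} {x : Fin n} where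

  chain⇒role : Chain t (t + d) π x → RoleΠ (suc t) d π x (suc t)
  chain⇒role C = ρ , ρ∈Π , occurrence , x-plays
    where open ChainOccurrence C

  chain⇒role-next : (C : Chain t (t + suc d) π x) → RoleΠ (suc t) (suc d) π (ch C t) (suc (suc t))
  chain⇒role-next C = ρ , ρ∈Π , occurrence , next-plays (m<m+n t z<s)
    where open ChainOccurrence C

  chain⇒assoc : ∀ {u} (C : Chain t (t + suc d) π x) → π (ch C t) ≡ u → AssocA1 (suc (suc t)) d π u x
  chain⇒assoc C πt≡u = ρ , ρ∈Π , occurrence , x-plays , ch C t , next-plays (m<m+n t z<s) , πt≡u
    where open ChainOccurrence C

clamp : ∀ {L} → ℕ → Fin (suc L)
clamp {zero}  _       = Fin.zero
clamp {suc L} zero    = Fin.zero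
clamp {suc L} (suc m) = Fin.suc (clamp m)

toℕ-clamp : ∀ {L m} → m ≤ L → toℕ (clamp {L} m) ≡ m
toℕ-clamp {zero}  z≤n       = refl
toℕ-clamp {suc L} {zero} _  = refl
toℕ-clamp {suc L} {suc m} (s≤s m≤L) = cong suc (toℕ-clamp m≤L)

same-role⇒same-value : ∀ {n k} {π : Fin n → ℕ} {ρ : Fin k → ℕ} (o : Occurrence π ρ) {j j'} →
               ρ j ≡ ρ j' → π (pos o j) ≡ π (pos o j')
same-role⇒same-value {π = π} o {j} {j'} ρj≡ρj' with <-cmp (π (pos o j)) (π (pos o j'))
... | tri< lt _ _ = contradiction ρj≡ρj' (<⇒≢ (iso← o _ _ lt))
... | tri≈ _ eq _ = eq
... | tri> _ _ gt = contradiction (sym ρj≡ρj') (<⇒≢ (iso← o _ _ gt))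

module OccurrenceChain {t d n : ℕ} {π : Fin n → ℕ} {ρ : Fin (suc t + d) → ℕ}
                       (ρ∈Π : InΠ (suc t) d ρ) (o : Occurrence π ρ) {j} (ρj : ρ j ≡ suc t) where

  private
    slot : ℕ
    slot = toℕ (proj₁ ρ∈Π)

    ρ-shape : ∀ j → ρ j ≡ insert slot (suc t) (restElem (suc t)) (toℕ j)
    ρ-shape = proj₂ (proj₂ ρ∈Π)

    j-at-slot : toℕ j ≡ slot
    j-at-slot = insert-≡-inv (restElem-≢ t) (trans (sym (ρ-shape j)) ρj)

    index : ℕ → Fin (suc (t + d))
    index m = clamp (skip slot m)

    toℕ-index : ∀ {m} → m < t + d → toℕ (index m) ≡ skip slot m
    toℕ-index {m} m<L = toℕ-clamp (≤-trans (skip-≤ slot m) m<L)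

    ρ-index : ∀ {m} → m < t + d → ρ (index m) ≡ restElem (suc t) m
    ρ-index {m} m<L = trans (ρ-shape (index m))
      (trans (cong (insert slot (suc t) (restElem (suc t))) (toℕ-index m<L))
             (insert-skip {x = suc t} {restElem (suc t)} slot m))

  chain : Chain t (t + d) π (pos o j)
  chain = record
    { ch         = pos o ∘ index
    ; increasing = λ {m} m<m' m'<L →
        incr o _ _ (subst₂ _<_ (sym (toℕ-index (<-trans m<m' m'<L))) (sym (toℕ-index m'<L))
                               (skip-increasing slot m<m' m'<L)) ,
        iso→ o _ _ (subst₂ _<_ (sym (ρ-index (<-trans m<m' m'<L))) (sym (ρ-index m'<L)) (restElem-increasing t m<m' m'<L))
    ; lower      = λ m<t → iso→ o _ _
                     (subst₂ _<_ (sym (ρ-index (<-≤-trans m<t (m≤m+n t d)))) (sym ρj) (restElem-below m<t))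
    ; upper      = λ t≤m m<L → iso→ o _ _ (subst₂ _<_ (sym ρj) (sym (ρ-index m<L)) (restElem-above t≤m))
    ; misplaced  = misplaced'
    }
    where
    misplaced' : (∃[ m ] m < t × pos o j <ᶠ pos o (index m)) ⊎
                 (∃[ m ] t ≤ m × m < t + d × pos o (index m) <ᶠ pos o j)
    misplaced' with <-cmp slot t
    ... | tri< slot<t _ _ =
          inj₁ (slot , slot<t , incr o _ _ (subst₂ _<_ (sym j-at-slot) (sym (toℕ-index slot<L)) slot<skip))
      where
      slot<L : slot < t + d
      slot<L = <-≤-trans slot<t (m≤m+n t d)
      slot<skip : slot < skip slot slot
      slot<skip = subst (slot <_) (sym (splice-≥ {f = λ m → m} {g = suc} {q = slot} ≤-refl)) (n<1+n slot)
    ... | tri≈ _ slot≡t _ = contradiction slot≡t (proj₁ (proj₂ ρ∈Π))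
    ... | tri> _ _ t<slot =
          inj₂ (t , ≤-refl , t<L , incr o _ _ (subst₂ _<_ (sym (toℕ-index t<L)) (sym j-at-slot) skip<slot))
      where
      t<L : t < t + d
      t<L = <-≤-trans t<slot (s≤s⁻¹ (toℕ<n (proj₁ ρ∈Π)))
      skip<slot : skip slot t < slot
      skip<slot = subst (_< slot) (sym (splice-< {f = λ m → m} {g = suc} t<slot)) t<slot

  π-next : ∀ {k} → t < t + d → PlaysRole o k (suc (suc t)) → π (ch chain t) ≡ π k
  π-next t<L (_ , ρk , refl) = same-role⇒same-value o (trans (ρ-index t<L) (trans (restElem-at t) (sym ρk)))

module _ {t d n : ℕ} {π : Fin n → ℕ} {x : Fin n} where

  role⇒chain : RoleΠ (suc t) d π x (suc t) → Chain t (t + d) π x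
  role⇒chain (_ , ρ∈Π , o , _ , ρj , refl) = OccurrenceChain.chain ρ∈Π o ρj

  assoc⇒chain : ∀ {u} → AssocA1 (suc (suc t)) d π u x → Σ (Chain t (t + suc d) π x) λ C → π (ch C t) ≡ u
  assoc⇒chain (_ , ρ∈Π , o , (_ , ρj , refl) , _ , k-plays , πk≡u) =
    chain , trans (π-next (m<m+n t z<s) k-plays) πk≡u
    where open OccurrenceChain ρ∈Π o ρj

module Rotation {n : ℕ} (π : Fin n → ℕ) (π-injective : Injective _≡_ _≡_ π)
                {w u} (w<u : w < u) {k : Fin n} (πk : π k ≡ u) where

  σ : Fin n → ℕ
  σ q = shiftVal w u (π q)

  private variable y y' : Fin n

  ≢k⇒≢u : y ≢ k → π y ≢ u
  ≢k⇒≢u y≢k πy≡u = y≢k (π-injective (trans πy≡u (sym πk)))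

  σ-reflects-< : y ≢ k → y' ≢ k → σ y < σ y' → π y < π y'
  σ-reflects-< y≢k y'≢k = shift-reflects-< w<u (≢k⇒≢u y≢k) (≢k⇒≢u y'≢k)

  σk : σ k ≡ w
  σk = trans (cong (shiftVal w u) πk) (shift-at w<u)

  σ<w⇒σ≡π : σ y < w → σ y ≡ π y
  σ<w⇒σ≡π = shift-fixed-below-w w<u

  u<σ⇒σ≡π : u < σ y → σ y ≡ π y
  u<σ⇒σ≡π = shift-fixed-above-u w<u

  w<σ⇒w≤π : w < σ y → w ≤ π y
  w<σ⇒w≤π = shift-above-w w<u

  transfer : ∀ {t L x} → t ≤ L → (O : Chain t L σ x) → x ≢ k → (∀ {m} → m < L → ch O m ≢ k) →
             Chain t L π x
  transfer t≤L O x≢k O≢k = record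
    { ch         = ch O
    ; increasing = λ m<m' m'<L → increasing-positions O m<m' m'<L ,
                                 σ-reflects-< (O≢k (<-trans m<m' m'<L)) (O≢k m'<L) (increasing-values O m<m' m'<L)
    ; lower      = λ m<t → σ-reflects-< (O≢k (<-≤-trans m<t t≤L)) x≢k (lower O m<t)
    ; upper      = λ t≤m m<L → σ-reflects-< x≢k (O≢k m<L) (upper O t≤m m<L)
    ; misplaced  = misplaced O
    }

module ChainVersion {n : ℕ} (π : Fin n → ℕ) (π-injective : Injective _≡_ _≡_ π) {t L : ℕ} (t<L : t < L)
  {w u : ℕ} {i j : Fin n} (πj : π j ≡ w)
  (P : Chain t L π j) (πPt : π (ch P t) ≡ u)
  (u-minimal : ∀ {x} (C : Chain t L π x) → u ≤ π (ch C t))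
  (O : Chain (suc t) L (λ q → shiftVal w u (π q)) i)
  (¬A : ¬ Chain (suc t) L π i) where

  private
    k : Fin n
    k = ch P t

  w<u : w < u
  w<u = subst₂ _<_ πj πPt (upper P ≤-refl t<L)

  open Rotation π π-injective w<u πPt

  P-head<w : ∀ {m} → m < t → π (ch P m) < w
  P-head<w m<t = subst (_ <_) πj (lower P m<t)

  u≤P-tail : ∀ {m} → t ≤ m → m < L → u ≤ π (ch P m)
  u≤P-tail t≤m m<L = subst (_≤ _) πPt (proj₂ (increasing-≤ P t≤m m<L))

  k≤P-tail : ∀ {m} → t ≤ m → m < L → k ≤ᶠ ch P m
  k≤P-tail t≤m m<L = proj₁ (increasing-≤ P t≤m m<L)

  i≢k : π i ≢ u → i ≢ k
  i≢k πi≢u i≡k = πi≢u (trans (cong π i≡k) πPt)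

  O-meets-k : π i ≢ u → ∃[ mk ] mk < L × ch O mk ≡ k
  O-meets-k πi≢u with anyUpTo? (λ m → ch O m Fin.≟ k) L
  ... | yes found = found
  ... | no ¬found = contradiction (transfer t<L O (i≢k πi≢u) (λ m<L e → ¬found (_ , m<L , e))) ¬A

  module AboveU (u<πi : u < π i) {mk} (mk<L : mk < L) (Omk≡k : ch O mk ≡ k) where

    ch' : ℕ → Fin n
    ch' = splice t (ch P) (ch O)

    ch'-≥ : ∀ {m} → t ≤ m → ch' m ≡ ch O m
    ch'-≥ = splice-≥ {f = ch P} {g = ch O}

    σi≡πi : σ i ≡ π i
    σi≡πi = shift-high w<u u<πi

    mk≤t : mk ≤ t
    mk≤t = ≮⇒≥ λ t<mk → <-asym (<-trans w<u u<πi)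
      (subst₂ _<_ σi≡πi (trans (cong σ Omk≡k) σk) (upper O t<mk mk<L))

    O≢k : ∀ {m} → m < L → m ≢ mk → ch O m ≢ k
    O≢k m<L m≢mk e = m≢mk (ch-injective O m<L mk<L (trans e (sym Omk≡k)))

    O-from-k : ∀ {m} → mk ≤ m → m < L → k ≤ᶠ ch O m
    O-from-k mk≤m m<L = subst (λ c → c ≤ᶠ _) Omk≡k (proj₁ (increasing-≤ O mk≤m m<L))

    w≤O : ∀ {m} → mk ≤ m → m < L → w ≤ π (ch O m)
    w≤O {m} mk≤m m<L with m ≟ mk
    ... | yes refl = subst (w ≤_) (sym (trans (cong π Omk≡k) πPt)) (<⇒≤ w<u)
    ... | no m≢mk  = w<σ⇒w≤π (subst (_< σ (ch O m)) (trans (cong σ Omk≡k) σk)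
                                  (increasing-values O (≤∧≢⇒< mk≤m (≢-sym m≢mk)) m<L))

    O-below-i : ∀ {m} → m < suc t → mk ≤ m → π (ch O m) < π i
    O-below-i {m} m<st mk≤m with m ≟ mk
    ... | yes refl = subst (_< π i) (sym (trans (cong π Omk≡k) πPt)) u<πi
    ... | no m≢mk  = σ-reflects-< (O≢k (<-≤-trans m<st t<L) m≢mk) (i≢k (≢-sym (<⇒≢ u<πi))) (lower O m<st)

    O-fixed : ∀ {m} → suc t ≤ m → m < L → σ (ch O m) ≡ π (ch O m)
    O-fixed st≤m m<L = u<σ⇒σ≡π (<-trans u<πi (subst (_< _) σi≡πi (upper O st≤m m<L)))

    O-above-i : ∀ {m} → suc t ≤ m → m < L → π i < π (ch O m)
    O-above-i st≤m m<L = subst₂ _<_ σi≡πi (O-fixed st≤m m<L) (upper O st≤m m<L)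

    O-increasing : ∀ {m m'} → t ≤ m → m < m' → m' < L → π (ch O m) < π (ch O m')
    O-increasing {m} t≤m m<m' m'<L with m <? suc t
    ... | yes m<st = <-trans (O-below-i m<st (≤-trans mk≤t t≤m)) (O-above-i (≤-<-trans t≤m m<m') m'<L)
    ... | no m≮st  = subst₂ _<_ (O-fixed (≮⇒≥ m≮st) (<-trans m<m' m'<L))
                                (O-fixed (≤-trans (≮⇒≥ m≮st) (<⇒≤ m<m')) m'<L)
                                (increasing-values O m<m' m'<L)

    misplaced' : (∃[ m ] m < suc t × i <ᶠ ch' m) ⊎ (∃[ m ] suc t ≤ m × m < L × ch' m <ᶠ i)
    misplaced' with misplaced O
    ... | inj₁ (m , m<st , i<Om) =
          inj₁ (t , n<1+n t , subst (λ c → i <ᶠ c) (sym (ch'-≥ ≤-refl))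
                                    (<-≤-trans i<Om (proj₁ (increasing-≤ O (s≤s⁻¹ m<st) t<L))))
    ... | inj₂ (m , st≤m , m<L , Om<i) =
          inj₂ (m , st≤m , m<L , subst (λ c → c <ᶠ i) (sym (ch'-≥ (≤-trans (n≤1+n t) st≤m))) Om<i)

    P-head-O-tail : Chain (suc t) L π i
    P-head-O-tail = record
      { ch         = ch'
      ; increasing = splice-increasing {f = ch P} {g = ch O} {q = t} {_R_ = _↗[ π ]_}
          (λ m<m' m'<t → increasing P m<m' (<-trans m'<t t<L))
          (λ t≤m m<m' m'<L → increasing-positions O m<m' m'<L , O-increasing t≤m m<m' m'<L)
          (λ m<t t≤m' m'<L → <-≤-trans (increasing-positions P m<t t<L) (O-from-k (≤-trans mk≤t t≤m') m'<L) ,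
                             <-≤-trans (P-head<w m<t) (w≤O (≤-trans mk≤t t≤m') m'<L))
      ; lower      = λ {m} m<st → splice-elim {f = ch P} {g = ch O} {q = t} (λ m c → m < suc t → π c < π i)
                       (λ m<t _ → <-trans (P-head<w m<t) (<-trans w<u u<πi))
                       (λ t≤m m<st → O-below-i m<st (≤-trans mk≤t t≤m)) m m<st
      ; upper      = λ st≤m m<L →
                       subst (λ c → π i < π c) (sym (ch'-≥ (≤-trans (n≤1+n t) st≤m))) (O-above-i st≤m m<L)
      ; misplaced  = misplaced'
      }

  module BelowW (πi<w : π i < w) {mk} (mk<L : mk < L) (Omk≡k : ch O mk ≡ k) where

    reindex : ℕ → ℕ
    reindex m = m ∸ mk + t

    P∘reindex : ℕ → Fin n
    P∘reindex m = ch P (reindex m)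

    ch' : ℕ → Fin n
    ch' = splice mk (ch O) P∘reindex

    ch'-< : ∀ {m} → m < mk → ch' m ≡ ch O m
    ch'-< = splice-< {f = ch O} {g = P∘reindex}

    σi≡πi : σ i ≡ π i
    σi≡πi = shift-low w<u πi<w

    σOmk≡w : σ (ch O mk) ≡ w
    σOmk≡w = trans (cong σ Omk≡k) σk

    st≤mk : suc t ≤ mk
    st≤mk = ≮⇒≥ λ mk<st → <-asym πi<w (subst₂ _<_ σOmk≡w σi≡πi (lower O mk<st))

    t≤reindex : ∀ m → t ≤ reindex m
    t≤reindex m = m≤n+m t (m ∸ mk)

    reindex<L : ∀ {m} → mk ≤ m → m < L → reindex m < L
    reindex<L {m} mk≤m m<L = <-trans (subst (reindex m <_) (m∸n+n≡m mk≤m) (+-monoʳ-< (m ∸ mk) st≤mk)) m<L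

    reindex-increasing : ∀ {m m'} → mk ≤ m → m < m' → reindex m < reindex m'
    reindex-increasing mk≤m m<m' = +-monoˡ-< t (∸-monoˡ-< m<m' mk≤m)

    O-fixed : ∀ {m} → m < mk → σ (ch O m) ≡ π (ch O m)
    O-fixed m<mk = σ<w⇒σ≡π (subst (_ <_) σOmk≡w (increasing-values O m<mk mk<L))

    O-below-w : ∀ {m} → m < mk → π (ch O m) < w
    O-below-w m<mk = subst₂ _<_ (O-fixed m<mk) σOmk≡w (increasing-values O m<mk mk<L)

    ch'-mk : ch' mk ≡ ch O mk
    ch'-mk = trans (splice-≥ {f = ch O} {g = P∘reindex} ≤-refl)
                   (trans (cong (λ m → ch P (m + t)) (n∸n≡0 mk)) (sym Omk≡k))

    misplaced' : (∃[ m ] m < suc t × i <ᶠ ch' m) ⊎ (∃[ m ] suc t ≤ m × m < L × ch' m <ᶠ i)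
    misplaced' with misplaced O
    ... | inj₁ (m , m<st , i<Om) = inj₁ (m , m<st , subst (λ c → i <ᶠ c) (sym (ch'-< (<-≤-trans m<st st≤mk))) i<Om)
    ... | inj₂ (m , st≤m , m<L , Om<i) with m <? mk
    ...   | yes m<mk = inj₂ (m , st≤m , m<L , subst (λ c → c <ᶠ i) (sym (ch'-< m<mk)) Om<i)
    ...   | no m≮mk  = inj₂ (mk , st≤mk , mk<L , subst (λ c → c <ᶠ i) (sym ch'-mk)
                              (≤-<-trans (proj₁ (increasing-≤ O (≮⇒≥ m≮mk) m<L)) Om<i))

    O-head-P-tail : Chain (suc t) L π i
    O-head-P-tail = record
      { ch         = ch'
      ; increasing = splice-increasing {f = ch O} {g = P∘reindex} {q = mk} {_R_ = _↗[ π ]_}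
          (λ m<m' m'<mk → increasing-positions O m<m' (<-trans m'<mk mk<L) ,
                          subst₂ _<_ (O-fixed (<-trans m<m' m'<mk)) (O-fixed m'<mk)
                                     (increasing-values O m<m' (<-trans m'<mk mk<L)))
          (λ mk≤m m<m' m'<L →
             increasing P (reindex-increasing mk≤m m<m') (reindex<L (≤-trans mk≤m (<⇒≤ m<m')) m'<L))
          (λ m<mk mk≤m' m'<L → <-≤-trans (subst (λ c → ch O _ <ᶠ c) Omk≡k (increasing-positions O m<mk mk<L))
                                          (k≤P-tail (t≤reindex _) (reindex<L mk≤m' m'<L)) ,
                               <-≤-trans (<-trans (O-below-w m<mk) w<u) (u≤P-tail (t≤reindex _) (reindex<L mk≤m' m'<L)))
      ; lower      = λ {m} m<st → subst (λ c → π c < π i) (sym (ch'-< (<-≤-trans m<st st≤mk)))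
                       (subst₂ _<_ (O-fixed (<-≤-trans m<st st≤mk)) σi≡πi (lower O m<st))
      ; upper      = λ {m} st≤m m<L →
                       splice-elim {f = ch O} {g = P∘reindex} {q = mk} (λ m c → suc t ≤ m → m < L → π i < π c)
                       (λ m<mk st≤m m<L → subst₂ _<_ σi≡πi (O-fixed m<mk) (upper O st≤m m<L))
                       (λ mk≤m _ m<L → <-trans πi<w (<-≤-trans w<u (u≤P-tail (t≤reindex _) (reindex<L mk≤m m<L))))
                       m st≤m m<L
      ; misplaced  = misplaced'
      }

  above-u : u < π i → ⊥
  above-u u<πi = let (_ , mk<L , Omk≡k) = O-meets-k (≢-sym (<⇒≢ u<πi))
                 in ¬A (AboveU.P-head-O-tail u<πi mk<L Omk≡k)

  below-w : π i < w → ⊥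
  below-w πi<w = let (_ , mk<L , Omk≡k) = O-meets-k (<⇒≢ (<-trans πi<w w<u))
                 in ¬A (BelowW.O-head-P-tail πi<w mk<L Omk≡k)

  module _ (w<πi : w < π i) (πi<u : π i < u) where

    retarget : (∃[ m ] m < t × i <ᶠ ch P m) ⊎ (∃[ m ] t ≤ m × m < L × ch P m <ᶠ i) → Chain t L π i
    retarget i-misplaced = record
      { ch         = ch P
      ; increasing = increasing P
      ; lower      = λ m<t → <-trans (P-head<w m<t) w<πi
      ; upper      = λ t≤m m<L → <-≤-trans πi<u (u≤P-tail t≤m m<L)
      ; misplaced  = i-misplaced
      }

    private
      ch+i : ℕ → Fin n
      ch+i = insert t i (ch P)

      ch+i-< : ∀ {m} → m < t → ch+i m ≡ ch P m
      ch+i-< = insert-< {x = i} {ch P}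

      ch+i-t : ch+i t ≡ i
      ch+i-t = insert-at {x = i} {ch P} {t}

      ch+i-> : ∀ {m} → t ≤ m → ch+i (suc m) ≡ ch P m
      ch+i-> = insert-> {x = i} {ch P}

    i-inserted : i <ᶠ k → (∀ {m} → m < t → ch P m <ᶠ i) → Chain t L π j
    i-inserted i<k P<i = record
      { ch         = ch+i
      ; increasing = λ m<m' m'<L → inserted-increasing m<m' (m<n⇒m<1+n m'<L)
      ; lower      = λ m<t → subst (λ c → π c < π j) (sym (ch+i-< m<t)) (lower P m<t)
      ; upper      = upper'
      ; misplaced  = misplaced'
      }
      where
      inserted-increasing : Increasing _↗[ π ]_ (suc L) ch+i
      inserted-increasing = insert-increasing {_R_ = _↗[ π ]_} (<⇒≤ t<L) (increasing P)
        (λ m<t → P<i m<t , <-trans (P-head<w m<t) w<πi)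
        (λ t≤m m<L → <-≤-trans i<k (k≤P-tail t≤m m<L) , <-≤-trans πi<u (u≤P-tail t≤m m<L))

      upper' : ∀ {m} → t ≤ m → m < L → π j < π (ch+i m)
      upper' {m} t≤m m<L with insertView t m
      ... | before m<t  = contradiction t≤m (<⇒≱ m<t)
      ... | at          = subst (λ c → π j < π c) (sym ch+i-t) (subst (_< π i) (sym πj) w<πi)
      ... | after t≤m₀  = subst (λ c → π j < π c) (sym (ch+i-> t≤m₀)) (upper P t≤m₀ (<-trans (n<1+n _) m<L))

      misplaced' : (∃[ m ] m < t × j <ᶠ ch+i m) ⊎ (∃[ m ] t ≤ m × m < L × ch+i m <ᶠ j)
      misplaced' with misplaced P
      ... | inj₁ (m , m<t , j<Pm) = inj₁ (m , m<t , subst (λ c → j <ᶠ c) (sym (ch+i-< m<t)) j<Pm)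
      ... | inj₂ (m , t≤m , m<L , Pm<j) =
            inj₂ (t , ≤-refl , t<L , subst (λ c → c <ᶠ j) (sym ch+i-t)
                                       (<-≤-trans i<k (≤-trans (k≤P-tail t≤m m<L) (<⇒≤ Pm<j))))

    between : Σ (Chain t L π i) λ C → π (ch C t) ≡ u
    between with <-cmp (toℕ k) (toℕ i)
    ... | tri< k<i _ _ = retarget (inj₂ (t , ≤-refl , t<L , k<i)) , πPt
    ... | tri≈ _ k≡i _ = contradiction (trans (cong π (sym (toℕ-injective k≡i))) πPt) (<⇒≢ πi<u)
    ... | tri> _ _ i<k with anyUpTo? (λ m → toℕ i <? toℕ (ch P m)) t
    ...   | yes (m , m<t , i<Pm) = retarget (inj₁ (m , m<t , i<Pm)) , πPt
    ...   | no ¬i<P = contradiction (u-minimal (i-inserted i<k P<i)) (<⇒≱ (subst (_< u) (sym (cong π ch+i-t)) πi<u))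
      where
      P<i : ∀ {m} → m < t → ch P m <ᶠ i
      P<i m<t = ≤∧≢⇒< (≮⇒≥ (λ i<Pm → ¬i<P (_ , m<t , i<Pm)))
                      (λ e → <⇒≢ (<-trans (P-head<w m<t) w<πi) (cong π (toℕ-injective e)))

  u-or-associated : π i ≡ u ⊎ Σ (Chain t L π i) λ C → π (ch C t) ≡ u
  u-or-associated with <-cmp (π i) u | <-cmp (π i) w
  ... | tri≈ _ πi≡u _ | _             = inj₁ πi≡u
  ... | tri> _ _ u<πi | _             = ⊥-elim (above-u u<πi)
  ... | tri< _ _ _    | tri< πi<w _ _ = ⊥-elim (below-w πi<w)
  ... | tri< _ _ _    | tri≈ _ πi≡w _ = inj₂ (subst (λ x → Σ (Chain t L π x) λ C → π (ch C t) ≡ u)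
                                                 (π-injective (trans πj (sym πi≡w))) (P , πPt))
  ... | tri< πi<u _ _ | tri> _ _ w<πi = inj₂ (between w<πi πi<u)

lemma2p10 : (a b n : ℕ) → 2 ≤ a → (π : Fin n → ℕ) → IsPerm n π →
    (σ : Fin n → ℕ) → IsS a b π σ → (i : Fin n) →
    ¬ RoleΠ a b π i a → RoleΠ a b σ i a →
    Σ ℕ (λ u → IsUnderA a b π u × (π i ≡ u ⊎ AssocA1 a b π u i))
lemma2p10 _ _ _ _ π _ .π (avoid _) _ ¬role σ-role = ⊥-elim (¬role σ-role)
lemma2p10 _ b _ (s≤s (s≤s {n = t} z≤n)) π (π-injective , _) _
          (move u w u-is-a@(_ , u-least) ((j , πj≡w , j-assoc) , _)) i ¬role σ-role =
  u , u-is-a , map₂ (λ (C , πCt≡u) → chain⇒assoc (resize (sym (+-suc t b)) C) πCt≡u) u-or-associated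
  where
  P : Σ (Chain t (t + suc b) π j) λ C → π (ch C t) ≡ u
  P = assoc⇒chain j-assoc
  open ChainVersion π π-injective (m≤m+n (suc t) b) πj≡w (resize (+-suc t b) (proj₁ P)) (proj₂ P)
            (λ C → u-least _ (chain⇒role-next (resize (sym (+-suc t b)) C)))
            (role⇒chain σ-role) (¬role ∘ chain⇒role)
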